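{- Let $T$ be a rooted tree. Then $\varphi_T(-1)=1$ if $T$ is the game tree of a game in which the second player has a winning strategy, and otherwise $\varphi_T(-1)=0$.
   Context: For a rooted tree $T$ whose root has children that are the roots of subtrees $T_1,\dots,T_m$, $\varphi_T(q)=\prod_{k=1}^m(1+q\varphi_{T_k}(q))$ (empty product $=1$). Game: a token starts at the root; two players alternate, the first player moving first; a move takes the token from its current vertex to one of its children; a player with no move loses. -}

module Defs where

open import Data.List using (List; []; _∷_)
open import Data.List.Relation.Unary.All using (All)
open import Data.List.Relation.Unary.Any using (Any)
open import Data.Integer using (ℤ; _+_; _*_; 1ℤ)

data Tree : Set where
  node : List Tree → Tree

mutual
  φ : Tree → ℤ → ℤ
  φ (node ts) q = φs ts q

  φs : List Tree → ℤ → ℤ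
  φs [] q = 1ℤ
  φs (t ∷ ts) q = (1ℤ + q * φ t q) * φs ts q

-- Game: token at the root, players alternate moving the token to a child;
-- a player with no move loses.
-- At the root the first player is to move, so PreviousWins T means the
-- second player has a winning strategy in the game tree T.
mutual
  data MoverWins : Tree → Set where
    moverWins : ∀ {ts} → Any PreviousWins ts → MoverWins (node ts)

  data PreviousWins : Tree → Set where
    previousWins : ∀ {ts} → All MoverWins ts → PreviousWins (node ts)

SecondPlayerWins : Tree → Set
SecondPlayerWins = PreviousWins

{-# OPTIONS --safe #-}
module Submission where

-- At q = -1 each factor of φ_T is 1 - φ_{T_k}(-1). By induction on T, φ is 1 at
-- positions lost by the player to move (every factor is 1 - 0) and 0 at positions
-- won by the player to move (some factor is 1 - 1); every finite game position is
-- one of the two.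

open import Defs
open import Data.Integer using (0ℤ; 1ℤ; -1ℤ; _+_; _*_)
open import Data.Integer.Properties using (*-zeroˡ; *-zeroʳ)
open import Data.List using (List; []; _∷_)
open import Data.List.Relation.Unary.All using (All; []; _∷_)
open import Data.List.Relation.Unary.Any using (Any; here; there)
open import Data.Product using (_×_; _,_)
open import Data.Sum using (_⊎_; inj₁; inj₂; [_,_]′)
import Data.Sum as Sum
open import Relation.Nullary using (¬_; contradiction)
open import Relation.Binary.PropositionalEquality using (_≡_; refl; cong; cong₂; trans)

mutual
  previousWins⇒φ≡1 : ∀ {t} → PreviousWins t → φ t -1ℤ ≡ 1ℤ
  previousWins⇒φ≡1 (previousWins ms) = allMoverWins⇒φs≡1 ms

  allMoverWins⇒φs≡1 : ∀ {ts} → All MoverWins ts → φs ts -1ℤ ≡ 1ℤ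
  allMoverWins⇒φs≡1 []       = refl
  allMoverWins⇒φs≡1 (m ∷ ms) =
    cong₂ (λ x y → (1ℤ + -1ℤ * x) * y) (moverWins⇒φ≡0 m) (allMoverWins⇒φs≡1 ms)

  moverWins⇒φ≡0 : ∀ {t} → MoverWins t → φ t -1ℤ ≡ 0ℤ
  moverWins⇒φ≡0 (moverWins ps) = anyPreviousWins⇒φs≡0 ps

  anyPreviousWins⇒φs≡0 : ∀ {ts} → Any PreviousWins ts → φs ts -1ℤ ≡ 0ℤ
  anyPreviousWins⇒φs≡0 {t ∷ ts} (here p) =
    trans (cong (λ x → (1ℤ + -1ℤ * x) * φs ts -1ℤ) (previousWins⇒φ≡1 p))
          (*-zeroˡ (φs ts -1ℤ))
  anyPreviousWins⇒φs≡0 {t ∷ ts} (there ps) =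
    trans (cong ((1ℤ + -1ℤ * φ t -1ℤ) *_) (anyPreviousWins⇒φs≡0 ps))
          (*-zeroʳ (1ℤ + -1ℤ * φ t -1ℤ))

mutual
  previousWins⊎moverWins : (t : Tree) → PreviousWins t ⊎ MoverWins t
  previousWins⊎moverWins (node ts) =
    Sum.map previousWins moverWins (allMoverWins⊎anyPreviousWins ts)

  allMoverWins⊎anyPreviousWins : (ts : List Tree) → All MoverWins ts ⊎ Any PreviousWins ts
  allMoverWins⊎anyPreviousWins []       = inj₁ []
  allMoverWins⊎anyPreviousWins (t ∷ ts) with previousWins⊎moverWins t
  ... | inj₁ p = inj₂ (here p)
  ... | inj₂ m = Sum.map (m ∷_) there (allMoverWins⊎anyPreviousWins ts)

mainTheorem16 : (T : Tree) →
    (SecondPlayerWins T → φ T -1ℤ ≡ 1ℤ) × (¬ SecondPlayerWins T → φ T -1ℤ ≡ 0ℤ)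
mainTheorem16 T =
  previousWins⇒φ≡1 ,
  λ ¬pw → [ (λ pw → contradiction pw ¬pw) , moverWins⇒φ≡0 ]′ (previousWins⊎moverWins T)
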